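{- Let $t<k$ be positive integers and $2\le v_1\le v_2\le\cdots\le v_k$ integers with $v_{k-t}<v_{k-t+1}<2v_{k-t}$. Then $(\bar{1},t)\text{ -LAN}(k,(v_1,\dots,v_k))\ge m$, where $$m=\begin{cases}\max\left\{\left\lceil \dfrac{2\sum_{k-t\le j_1<\cdots<j_t\le k}\prod_{s=1}^{t} v_{j_s}}{t+2}\right\rceil,\ \prod_{i=k-t+1}^{k} v_i+\prod_{i=k-t+2}^{k} v_i\right\}, & t\ge 2,\\[2mm] \left\lceil \dfrac{2v_{k-1}+2v_k}{3}\right\rceil, & t=1.\end{cases}$$
   Context: Let $k,t,N$ be positive integers with $t<k$. For positive integers $v_1,\dots,v_k$, consider $N\times k$ arrays $A=(a_{rj})$ whose $j$-th column has entries from a fixed set $V_j$ with $|V_j|=v_j$. A $t$-way interaction is a set $T=\{(j,\sigma_j): j\in I\}$ with $I\subseteq\{1,\dots,k\}$, $|I|=t$, $\sigma_j\in V_j$. Let $\rho(A,T)$ be the set of row indices $r$ with $a_{rj}=\sigma_j$ for all $j\in I$, and $\rho(A,\mathcal T)=\bigcup_{T\in\mathcal T}\rho(A,T)$. $A$ is a $(\bar 1,t)$-LA$(N;k,(v_1,\dots,v_k))$ if for all sets $\mathcal T_1,\mathcal T_2$ of $t$-way interactions with $|\mathcal T_1|\le1$, $|\mathcal T_2|\le1$: $\rho(A,\mathcal T_1)=\rho(A,\mathcal T_2)\iff \mathcal T_1=\mathcal T_2$ (equivalently: every $t$-way interaction occurs in some row, and distinct $t$-way interactions have distinct $\rho$).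 $(\bar1,t)$-LAN$(k,(v_1,\dots,v_k))$ is the minimum $N$ for which such an array exists. -}

module Defs where

open import Data.Nat using (ℕ; zero; suc; _+_; _*_; _∸_; _≤_; _<_; _⊔_; NonZero)
open import Data.Nat.DivMod using (_/_)
open import Data.Fin using (Fin; toℕ) renaming (zero to fzero; suc to fsuc)
open import Data.Maybe using (Maybe; just; nothing)
open import Data.List using (List; []; _∷_; map; upTo)
open import Data.Nat.ListAction using (product)
open import Data.Product using (_×_; Σ; _,_)
open import Data.Empty using (⊥)
open import Data.Unit using (⊤)
open import Relation.Binary.PropositionalEquality using (_≡_)
open import Function.Bundles using (_⇔_)

⌈_/_⌉ : ℕ → (b : ℕ) → .{{NonZero b}} → ℕ
⌈ a / b ⌉ = (a + b ∸ 1) / b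

range : ℕ → ℕ → List ℕ
range a b = map (a +_) (upTo (suc b ∸ a))

prodRange : (ℕ → ℕ) → ℕ → ℕ → ℕ
prodRange v a b = product (map v (range a b))

-- elementary symmetric sum: esym xs t = Σ over t-element index subsets
-- j₁ < ⋯ < j_t of xs of the product of the chosen entries
esym : List ℕ → ℕ → ℕ
esym []       zero    = 1
esym []       (suc t) = 0
esym (x ∷ xs) zero    = 1
esym (x ∷ xs) (suc t) = x * esym xs t + esym xs (suc t)

-- Locating arrays.  Columns are indexed by Fin k; the levels are given
-- by a 1-indexed function v : ℕ → ℕ, column j (0-based) having the
-- symbol set V_j = Fin (v (1 + toℕ j)).

Level : (k : ℕ) → (ℕ → ℕ) → Fin k → ℕ
Level k v j = v (suc (toℕ j))

Array : ℕ → (k : ℕ) → (ℕ → ℕ) → Set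
Array N k v = Fin N → (j : Fin k) → Fin (Level k v j)

support : ∀ {k} {F : Fin k → Set} → ((j : Fin k) → Maybe (F j)) → ℕ
support {zero}  τ = 0
support {suc k} τ with τ fzero
... | just _  = suc (support {k} (λ j → τ (fsuc j)))
... | nothing = support {k} (λ j → τ (fsuc j))

-- a t-way interaction {(j, σ_j) : j ∈ I}, |I| = t, represented as the
-- partial assignment j ↦ just σ_j (j ∈ I), nothing (j ∉ I)
record Interaction (t k : ℕ) (v : ℕ → ℕ) : Set where
  constructor interaction
  field
    assign : (j : Fin k) → Maybe (Fin (Level k v j))
    size   : support assign ≡ t

_≈I_ : ∀ {t k v} → Interaction t k v → Interaction t k v → Set
interaction τ₁ _ ≈I interaction τ₂ _ = ∀ j → τ₁ j ≡ τ₂ j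

InRho : ∀ {N k t v} → Array N k v → Interaction t k v → Fin N → Set
InRho A (interaction τ _) r = ∀ j (x : _) → τ j ≡ just x → A r j ≡ x

-- sets 𝒯 of t-way interactions with |𝒯| ≤ 1 : nothing = ∅, just T = {T}
InRhoSet : ∀ {N k t v} → Array N k v → Maybe (Interaction t k v) → Fin N → Set
InRhoSet A nothing  r = ⊥
InRhoSet A (just T) r = InRho A T r

_≈S_ : ∀ {t k v} → Maybe (Interaction t k v) → Maybe (Interaction t k v) → Set
nothing ≈S nothing = ⊤
nothing ≈S just _  = ⊥
just _  ≈S nothing = ⊥
just T₁ ≈S just T₂ = T₁ ≈I T₂

IsLA1 : (N t k : ℕ) (v : ℕ → ℕ) → Array N k v → Set
IsLA1 N t k v A =
  (𝒯₁ 𝒯₂ : Maybe (Interaction t k v)) →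
  ((∀ r → (InRhoSet A 𝒯₁ r ⇔ InRhoSet A 𝒯₂ r)) ⇔ (𝒯₁ ≈S 𝒯₂))

boundM : (t k : ℕ) → (ℕ → ℕ) → ℕ
boundM zero k v = 0
boundM (suc zero) k v = ⌈ 2 * v (k ∸ 1) + 2 * v k / 3 ⌉
boundM t@(suc (suc _)) k v =
  ⌈ 2 * esym (map v (range (k ∸ t) k)) t / t + 2 ⌉
  ⊔ (prodRange v (k ∸ t + 1) k + prodRange v (k ∸ t + 2) k)

{-# OPTIONS --safe #-}

-- Only the last t + 1 columns matter.  Restricting rows to a set S of columns and
-- encoding the restriction as a number below ∏_{j ∈ S} v_j gives a map out of the N
-- rows.  For |S| = t it is onto, since every t-way interaction is covered, and a row
-- alone in its fibre is the whole ρ of the interaction it shows, so by distinctness it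
-- is alone for at most one such S.  For the t + 1 sets S omitting one of the last t + 1
-- columns, every fibre has two rows unless it is such a singleton, which gives
-- 2 e_t(v_{k−t}, …, v_k) ≤ (t + 2) N.  For t ≥ 2 let J be the last t − 1 columns.
-- A J-fibre with at most v_{k−t+1} rows splits into singletons by column k − t + 1 and,
-- as v_{k−t+1} < 2 v_{k−t}, has a singleton cell by column k − t as well; its row would
-- be alone for two different t-sets.  So every J-fibre has more than v_{k−t+1} rows,
-- and N ≥ (v_{k−t+1} + 1) ∏_{j > k−t+1} v_j.

module Submission where

open import Defs
open import Data.Nat using (ℕ; zero; suc; _+_; _*_; _∸_; _≤_; _<_; z≤n; s≤s; _<?_; _≤?_)
import Data.Nat.Properties as ℕₚ
open ℕₚ hiding (_≟_; suc-injective)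
open import Data.Nat.DivMod using (m<n*o⇒m/o<n)
open import Data.Nat.ListAction using (product)
open import Data.Bool using (Bool; true; false; if_then_else_)
open import Data.Fin using (Fin; zero; suc; toℕ; fromℕ<; combine; _↑ʳ_)
open import Data.Fin.Properties using (_≟_; suc-injective; any?; toℕ<n; toℕ-↑ʳ; combine-injective; combine-surjective)
open import Data.List using (_∷_; map; tabulate; upTo; applyUpTo)
open import Data.List.Properties using (map-∘; map-upTo; tabulate-cong)
open import Data.Maybe using (Maybe; just; nothing)
open import Data.Product using (∃; _,_; <_,_>)
open import Data.Product.Properties using (,-injectiveˡ; ,-injectiveʳ)
open import Data.Empty using (⊥; ⊥-elim)
open import Function using (_∘_)
open import Function.Bundles using (_⇔_; mk⇔; Equivalence)
open import Function.Construct.Composition using (_⇔-∘_)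
open import Function.Construct.Symmetry using (⇔-sym)
open import Relation.Nullary using (Dec; does; yes; no; _×-dec_)
open import Relation.Unary using (Pred; Decidable)
open import Relation.Binary.PropositionalEquality
open import Algebra.Properties.Semiring.Sum ℕₚ.+-*-semiring
  using (sum; sum-syntax; ∑-comm; ∑-distrib-+; *-distribˡ-sum; *-distribʳ-sum; sum-cong-≗)

∑-const : ∀ n c → ∑[ i < n ] c ≡ n * c
∑-const zero    c = refl
∑-const (suc n) c = cong (c +_) (∑-const n c)

∑-mono-≤ : ∀ {n} {f g : Fin n → ℕ} → (∀ i → f i ≤ g i) → sum f ≤ sum g
∑-mono-≤ {zero}  f≤g = z≤n
∑-mono-≤ {suc n} f≤g = +-mono-≤ (f≤g zero) (∑-mono-≤ (f≤g ∘ suc))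

term≤∑ : ∀ {n} (f : Fin n → ℕ) i → f i ≤ sum f
term≤∑ f zero    = m≤m+n _ _
term≤∑ f (suc i) = ≤-trans (term≤∑ (f ∘ suc) i) (m≤n+m _ _)

two-terms≤∑ : ∀ {n} (f : Fin n → ℕ) {i j} → i ≢ j → f i + f j ≤ sum f
two-terms≤∑ f {zero}  {zero}  i≢j = ⊥-elim (i≢j refl)
two-terms≤∑ f {zero}  {suc j} i≢j = +-monoʳ-≤ (f zero) (term≤∑ (f ∘ suc) j)
two-terms≤∑ f {suc i} {zero}  i≢j =
  subst (_≤ sum f) (+-comm (f zero) (f (suc i))) (+-monoʳ-≤ (f zero) (term≤∑ (f ∘ suc) i))
two-terms≤∑ f {suc i} {suc j} i≢j =
  ≤-trans (two-terms≤∑ (f ∘ suc) (i≢j ∘ cong suc)) (m≤n+m _ _)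

∑≤n⇒≡1 : ∀ {n} (f : Fin n → ℕ) → (∀ i → 1 ≤ f i) → sum f ≤ n → ∀ i → f i ≡ 1
∑≤n⇒≡1 {suc n} f 1≤f ∑≤n zero = ≤-antisym (+-cancelʳ-≤ n (f zero) 1 f₀+n≤1+n) (1≤f zero)
  where
  f₀+n≤1+n : f zero + n ≤ 1 + n
  f₀+n≤1+n = begin
    f zero + n               ≡⟨ cong (f zero +_) (*-identityʳ n) ⟨
    f zero + n * 1           ≡⟨ cong (f zero +_) (∑-const n 1) ⟨
    f zero + ∑[ i < n ] 1    ≤⟨ +-monoʳ-≤ (f zero) (∑-mono-≤ (1≤f ∘ suc)) ⟩
    sum f                    ≤⟨ ∑≤n ⟩
    suc n                    ∎
    where open ≤-Reasoning
∑≤n⇒≡1 {suc n} f 1≤f ∑≤n (suc i) =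
  ∑≤n⇒≡1 (f ∘ suc) (1≤f ∘ suc) (+-cancelˡ-≤ 1 _ _ (≤-trans (+-monoˡ-≤ _ (1≤f zero)) ∑≤n)) i

∑<n*c⇒∃< : ∀ {n} (f : Fin n → ℕ) c → sum f < n * c → ∃ λ i → f i < c
∑<n*c⇒∃< {suc n} f c ∑<n*c with f zero <? c
... | yes f₀<c = zero , f₀<c
... | no f₀≮c with ∑<n*c⇒∃< (f ∘ suc) c (+-cancelˡ-< c _ _ (≤-<-trans (+-monoˡ-≤ _ (≮⇒≥ f₀≮c)) ∑<n*c))
...   | i , fᵢ<c = suc i , fᵢ<c

𝟙 : ∀ {p} {P : Set p} → Dec P → ℕ
𝟙 P? = if does P? then 1 else 0

𝟙-× : ∀ {p q} {P : Set p} {Q : Set q} (P? : Dec P) (Q? : Dec Q) → 𝟙 (P? ×-dec Q?) ≡ 𝟙 P? * 𝟙 Q?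
𝟙-× (yes _) (yes _) = refl
𝟙-× (yes _) (no _)  = refl
𝟙-× (no _)  _       = refl

𝟙-yes : ∀ {p} {P : Set p} (P? : Dec P) → P → 𝟙 P? ≡ 1
𝟙-yes (yes _) _ = refl
𝟙-yes (no ¬p) p = ⊥-elim (¬p p)

module _ {n p} {P : Pred (Fin n) p} (P? : Decidable P) where

  count : ℕ
  count = ∑[ i < n ] 𝟙 (P? i)

  count-pos : ∀ i → P i → 1 ≤ count
  count-pos i pᵢ = subst (_≤ count) (𝟙-yes (P? i) pᵢ) (term≤∑ _ i)

  count≡1⇒unique : count ≡ 1 → ∀ {i j} → P i → P j → i ≡ j
  count≡1⇒unique count≡1 {i} {j} pᵢ pⱼ with i ≟ j
  ... | yes i≡j = i≡j
  ... | no i≢j  = ⊥-elim (<-irrefl refl (begin-strict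
    1                    <⟨ s≤s ≤-refl ⟩
    1 + 1                ≡⟨ cong₂ _+_ (𝟙-yes (P? i) pᵢ) (𝟙-yes (P? j) pⱼ) ⟨
    𝟙 (P? i) + 𝟙 (P? j)  ≤⟨ two-terms≤∑ _ i≢j ⟩
    count                ≡⟨ count≡1 ⟩
    1                    ∎))
    where open ≤-Reasoning

count≤1 : ∀ {n p} {P : Pred (Fin n) p} (P? : Decidable P) → (∀ {i j} → P i → P j → i ≡ j) → count P? ≤ 1
count≤1 {zero}  P? unique = z≤n
count≤1 {suc n} P? unique with P? zero
... | yes p₀ = s≤s (≤-reflexive (trans (sum-cong-≗ none) (trans (∑-const n 0) (*-zeroʳ n))))
  where
  none : ∀ i → 𝟙 (P? (suc i)) ≡ 0
  none i with P? (suc i)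
  ... | yes pᵢ with () ← unique p₀ pᵢ
  ... | no _ = refl
... | no _ = count≤1 (P? ∘ suc) (λ pᵢ pⱼ → suc-injective (unique pᵢ pⱼ))

∑-select : ∀ {n} (x : Fin n) (g : Fin n → ℕ) → ∑[ y < n ] (𝟙 (x ≟ y) * g y) ≡ g x
∑-select {suc n} zero    g = begin
  g zero + 0 + ∑[ y < n ] 0  ≡⟨ cong₂ _+_ (+-identityʳ (g zero)) (∑-const n 0) ⟩
  g zero + n * 0             ≡⟨ cong (g zero +_) (*-zeroʳ n) ⟩
  g zero + 0                 ≡⟨ +-identityʳ (g zero) ⟩
  g zero                     ∎
  where open ≡-Reasoning
∑-select {suc n} (suc x) g = ∑-select x (g ∘ suc)

module _ {N M} (f : Fin N → Fin M) where

  fibre : Fin M → ℕ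
  fibre y = count (λ r → f r ≟ y)

  ∑-fibres : (g : Fin M → ℕ) → ∑[ r < N ] g (f r) ≡ ∑[ y < M ] (fibre y * g y)
  ∑-fibres g = begin
    ∑[ r < N ] g (f r)                         ≡⟨ sum-cong-≗ (λ r → ∑-select (f r) g) ⟨
    ∑[ r < N ] ∑[ y < M ] (𝟙 (f r ≟ y) * g y)  ≡⟨ ∑-comm (λ r y → 𝟙 (f r ≟ y) * g y) ⟩
    ∑[ y < M ] ∑[ r < N ] (𝟙 (f r ≟ y) * g y)  ≡⟨ sum-cong-≗ (λ y → *-distribʳ-sum (g y) (λ r → 𝟙 (f r ≟ y))) ⟨
    ∑[ y < M ] (fibre y * g y)                 ∎
    where open ≡-Reasoning

count-partition : ∀ {N p} {P : Pred (Fin N) p} (P? : Decidable P) {a} (g : Fin N → Fin a) →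
                  count P? ≡ ∑[ x < a ] count (λ r → P? r ×-dec g r ≟ x)
count-partition {N} P? {a} g = begin
  ∑[ r < N ] 𝟙 (P? r)                             ≡⟨ sum-cong-≗ (λ r → ∑-select (g r) (λ _ → 𝟙 (P? r))) ⟨
  ∑[ r < N ] ∑[ x < a ] (𝟙 (g r ≟ x) * 𝟙 (P? r))  ≡⟨ ∑-comm (λ r x → 𝟙 (g r ≟ x) * 𝟙 (P? r)) ⟩
  ∑[ x < a ] ∑[ r < N ] (𝟙 (g r ≟ x) * 𝟙 (P? r))  ≡⟨ sum-cong-≗ (λ x → sum-cong-≗ (𝟙-×-comm x)) ⟩
  ∑[ x < a ] count (λ r → P? r ×-dec g r ≟ x)     ∎
  where
  open ≡-Reasoning
  𝟙-×-comm : ∀ x r → 𝟙 (g r ≟ x) * 𝟙 (P? r) ≡ 𝟙 (P? r ×-dec g r ≟ x)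
  𝟙-×-comm x r = trans (*-comm (𝟙 (g r ≟ x)) (𝟙 (P? r))) (sym (𝟙-× (P? r) (g r ≟ x)))

Surjective : {A B : Set} → (A → B) → Set
Surjective f = ∀ y → ∃ λ x → f x ≡ y

Alone : ∀ {N} {B : Set} → (Fin N → B) → Fin N → Set
Alone f r = ∀ {r′} → f r′ ≡ f r → r′ ≡ r

module _ {N M} (f : Fin N → Fin M) where

  alone? : Decidable (λ r → fibre f (f r) ≡ 1)
  alone? r = fibre f (f r) ℕₚ.≟ 1

  fibre≡1⇒Alone : ∀ {r} → fibre f (f r) ≡ 1 → Alone f r
  fibre≡1⇒Alone fibre≡1 fr′≡fr = count≡1⇒unique (λ r → f r ≟ _) fibre≡1 fr′≡fr refl

  surjective⇒fibre-pos : Surjective f → ∀ y → 1 ≤ fibre f y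
  surjective⇒fibre-pos surj y with surj y
  ... | r , fr≡y = count-pos (λ r → f r ≟ y) r fr≡y

  surjective⇒2M≤N+alone : Surjective f → 2 * M ≤ N + count alone?
  surjective⇒2M≤N+alone surj = begin
    2 * M                                               ≡⟨ *-comm 2 M ⟩
    M * 2                                               ≡⟨ ∑-const M 2 ⟨
    ∑[ y < M ] 2                                        ≤⟨ ∑-mono-≤ (2≤s*[1+𝟙] ∘ surjective⇒fibre-pos surj) ⟩
    ∑[ y < M ] (fibre f y * (1 + 𝟙 (fibre f y ℕₚ.≟ 1)))  ≡⟨ ∑-fibres f (λ y → 1 + 𝟙 (fibre f y ℕₚ.≟ 1)) ⟨
    ∑[ r < N ] (1 + 𝟙 (alone? r))                       ≡⟨ ∑-distrib-+ (λ _ → 1) (𝟙 ∘ alone?) ⟩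
    ∑[ r < N ] 1 + count alone?                         ≡⟨ cong (_+ count alone?) (trans (∑-const N 1) (*-identityʳ N)) ⟩
    N + count alone?                                    ∎
    where
    open ≤-Reasoning
    2≤s*[1+𝟙] : ∀ {s} → 1 ≤ s → 2 ≤ s * (1 + 𝟙 (s ℕₚ.≟ 1))
    2≤s*[1+𝟙] {suc zero}    _ = ≤-refl
    2≤s*[1+𝟙] {suc (suc s)} _ = s≤s (s≤s z≤n)

module _ {N n} {M : Fin n → ℕ} (f : (d : Fin n) → Fin N → Fin (M d)) where

  disjoint-singletons-bound : (∀ d → Surjective (f d)) →
                              (∀ r {d d′} → Alone (f d) r → Alone (f d′) r → d ≡ d′) →
                              2 * ∑[ d < n ] M d ≤ suc n * N
  disjoint-singletons-bound surj alone-unique = begin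
    2 * ∑[ d < n ] M d                               ≡⟨ *-distribˡ-sum 2 M ⟩
    ∑[ d < n ] (2 * M d)                             ≤⟨ ∑-mono-≤ (λ d → surjective⇒2M≤N+alone (f d) (surj d)) ⟩
    ∑[ d < n ] (N + count (alone? (f d)))            ≡⟨ ∑-distrib-+ (λ _ → N) (λ d → count (alone? (f d))) ⟩
    ∑[ d < n ] N + ∑[ d < n ] count (alone? (f d))   ≡⟨ cong₂ _+_ (∑-const n N) (∑-comm (λ d r → 𝟙 (alone? (f d) r))) ⟩
    n * N + ∑[ r < N ] count (λ d → alone? (f d) r)  ≤⟨ +-monoʳ-≤ (n * N) (∑-mono-≤ at-most-one) ⟩
    n * N + ∑[ r < N ] 1                             ≡⟨ cong (n * N +_) (trans (∑-const N 1) (*-identityʳ N)) ⟩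
    n * N + N                                        ≡⟨ +-comm (n * N) N ⟩
    suc n * N                                        ∎
    where
    open ≤-Reasoning
    at-most-one : ∀ r → count (λ d → alone? (f d) r) ≤ 1
    at-most-one r = count≤1 (λ d → alone? (f d) r)
      (λ alone₁ alone₂ → alone-unique r (fibre≡1⇒Alone (f _) alone₁) (fibre≡1⇒Alone (f _) alone₂))

module _ {N M a b} (f : Fin N → Fin M) (p : Fin N → Fin a) (q : Fin N → Fin b) where

  -- A fibre of f with at most a points has only singleton p-cells and, as a < 2 * b,
  -- also a singleton q-cell; the point of that q-cell would be alone for both.
  refined-fibres-bound : a < 2 * b →
                         Surjective < f , p > → Surjective < f , q > →
                         (∀ r → Alone < f , p > r → Alone < f , q > r → ⊥) →
                         M * suc a ≤ N
  refined-fibres-bound a<2b surjp surjq not-both = begin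
    M * suc a                        ≡⟨ ∑-const M (suc a) ⟨
    ∑[ σ < M ] suc a                 ≤⟨ ∑-mono-≤ large-fibre ⟩
    ∑[ σ < M ] fibre f σ             ≡⟨ sum-cong-≗ (λ σ → *-identityʳ (fibre f σ)) ⟨
    ∑[ σ < M ] (fibre f σ * 1)       ≡⟨ ∑-fibres f (λ _ → 1) ⟨
    ∑[ r < N ] 1                     ≡⟨ trans (∑-const N 1) (*-identityʳ N) ⟩
    N                                ∎
    where
    open ≤-Reasoning
    cell : ∀ {c} (g : Fin N → Fin c) → Fin M → Fin c → ℕ
    cell g σ x = count (λ r → f r ≟ σ ×-dec g r ≟ x)

    cell-pos : ∀ {c} (g : Fin N → Fin c) → Surjective < f , g > → ∀ σ x → 1 ≤ cell g σ x
    cell-pos g surj σ x with surj (σ , x)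
    ... | r , refl = count-pos (λ r → f r ≟ σ ×-dec g r ≟ x) r (refl , refl)

    cell≡1⇒Alone : ∀ {c} (g : Fin N → Fin c) {r} → cell g (f r) (g r) ≡ 1 → Alone < f , g > r
    cell≡1⇒Alone g {r} cell≡1 eq =
      count≡1⇒unique (λ r′ → f r′ ≟ f r ×-dec g r′ ≟ g r) cell≡1 (,-injectiveˡ eq , ,-injectiveʳ eq) (refl , refl)

    p-cells-singletons : ∀ {σ} → fibre f σ ≤ a → ∀ x → cell p σ x ≡ 1
    p-cells-singletons {σ} fibre≤a = ∑≤n⇒≡1 (cell p σ) (cell-pos p surjp σ)
      (subst (_≤ a) (count-partition (λ r → f r ≟ σ) p) fibre≤a)

    small-q-cell : ∀ {σ} → fibre f σ ≤ a → ∃ λ y → cell q σ y < 2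
    small-q-cell {σ} fibre≤a = ∑<n*c⇒∃< (cell q σ) 2
      (subst₂ _<_ (count-partition (λ r → f r ≟ σ) q) (*-comm 2 b) (≤-<-trans fibre≤a a<2b))

    no-small-fibre : ∀ {σ} → fibre f σ ≤ a → ⊥
    no-small-fibre {σ} fibre≤a with small-q-cell fibre≤a
    ... | y , cell<2 with surjq (σ , y)
    ...   | r , refl = not-both r
      (cell≡1⇒Alone p (p-cells-singletons fibre≤a (p r)))
      (cell≡1⇒Alone q (≤-antisym (≤-pred cell<2) (cell-pos q surjq (f r) (q r))))

    large-fibre : ∀ σ → suc a ≤ fibre f σ
    large-fibre σ with suc a ≤? fibre f σ
    ... | yes a<fibre = a<fibre
    ... | no a≮fibre  = ⊥-elim (no-small-fibre (≤-pred (≰⇒> a≮fibre)))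

Mask : ℕ → Set
Mask n = Fin n → Bool

_⊆_ : ∀ {n} → Mask n → Mask n → Set
m ⊆ m′ = ∀ j → m j ≡ true → m′ j ≡ true

∣_∣ : ∀ {n} → Mask n → ℕ
∣_∣ {zero}  m = 0
∣_∣ {suc n} m = (if m zero then 1 else 0) + ∣ m ∘ suc ∣

∏[_]_ : ∀ {n} → Mask n → (Fin n → ℕ) → ℕ
∏[_]_ {zero}  m w = 1
∏[_]_ {suc n} m w = if m zero then w zero * ∏[ m ∘ suc ] (w ∘ suc) else ∏[ m ∘ suc ] (w ∘ suc)

∏-cong : ∀ {n} (m : Mask n) {w w′ : Fin n → ℕ} → (∀ i → w i ≡ w′ i) → ∏[ m ] w ≡ ∏[ m ] w′
∏-cong {zero}  m w≗w′ = refl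
∏-cong {suc n} m w≗w′ with m zero
... | true  = cong₂ _*_ (w≗w′ zero) (∏-cong (m ∘ suc) (w≗w′ ∘ suc))
... | false = ∏-cong (m ∘ suc) (w≗w′ ∘ suc)

∏-full : ∀ {n} {m : Mask n} → (∀ i → m i ≡ true) → (w : Fin n → ℕ) → ∏[ m ] w ≡ product (tabulate w)
∏-full {zero}          full w = refl
∏-full {suc n} {m} full w with m zero | full zero
... | true | refl = cong (w zero *_) (∏-full (full ∘ suc) (w ∘ suc))

∣∣-full : ∀ {n} {m : Mask n} → (∀ i → m i ≡ true) → ∣ m ∣ ≡ n
∣∣-full {zero}          full = refl
∣∣-full {suc n} {m} full with m zero | full zero
... | true | refl = cong suc (∣∣-full (full ∘ suc))

omit : ∀ {n} → Fin n → Mask n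
omit zero    zero    = false
omit zero    (suc i) = true
omit (suc d) zero    = true
omit (suc d) (suc i) = omit d i

∣omit∣ : ∀ {n} (d : Fin (suc n)) → ∣ omit d ∣ ≡ n
∣omit∣ zero           = ∣∣-full {m = omit zero ∘ suc} (λ _ → refl)
∣omit∣ {suc n} (suc d) = cong suc (∣omit∣ d)

omit-injective : ∀ {n} {d d′ : Fin n} → (∀ i → omit d i ≡ omit d′ i) → d ≡ d′
omit-injective {d = zero}  {zero}   same = refl
omit-injective {d = zero}  {suc d′} same with () ← same zero
omit-injective {d = suc d} {zero}   same with () ← same zero
omit-injective {d = suc d} {suc d′} same = cong suc (omit-injective (same ∘ suc))

esym-tabulate-above : ∀ {n} (w : Fin n → ℕ) {s} → n < s → esym (tabulate w) s ≡ 0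
esym-tabulate-above {zero}  w {suc s} n<s     = refl
esym-tabulate-above {suc n} w {suc s} (s≤s n<s) = begin
  w zero * esym (tabulate (w ∘ suc)) s + esym (tabulate (w ∘ suc)) (suc s)
    ≡⟨ cong₂ (λ x y → w zero * x + y) (esym-tabulate-above (w ∘ suc) n<s)
                                       (esym-tabulate-above (w ∘ suc) (m≤n⇒m≤1+n n<s)) ⟩
  w zero * 0 + 0
    ≡⟨ trans (+-identityʳ _) (*-zeroʳ (w zero)) ⟩
  0 ∎
  where open ≡-Reasoning

esym-tabulate-top : ∀ {n} (w : Fin n → ℕ) → esym (tabulate w) n ≡ product (tabulate w)
esym-tabulate-top {zero}  w = refl
esym-tabulate-top {suc n} w = begin
  w zero * esym (tabulate (w ∘ suc)) n + esym (tabulate (w ∘ suc)) (suc n)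
    ≡⟨ cong₂ (λ x y → w zero * x + y) (esym-tabulate-top (w ∘ suc)) (esym-tabulate-above (w ∘ suc) ≤-refl) ⟩
  w zero * product (tabulate (w ∘ suc)) + 0
    ≡⟨ +-identityʳ _ ⟩
  product (tabulate w) ∎
  where open ≡-Reasoning

∑∏omit≡esym : ∀ {n} (w : Fin (suc n) → ℕ) → ∑[ d < suc n ] ∏[ omit d ] w ≡ esym (tabulate w) n
∑∏omit≡esym {zero}  w = refl
∑∏omit≡esym {suc n} w = begin
  ∏[ omit zero ] w + ∑[ d < suc n ] ∏[ omit (suc d) ] w
    ≡⟨ cong₂ _+_ (∏-full {m = omit zero ∘ suc} (λ _ → refl) (w ∘ suc))
                 (sym (*-distribˡ-sum (w zero) (λ d → ∏[ omit d ] (w ∘ suc)))) ⟩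
  product (tabulate (w ∘ suc)) + w zero * ∑[ d < suc n ] ∏[ omit d ] (w ∘ suc)
    ≡⟨ cong₂ _+_ (esym-tabulate-top (w ∘ suc)) (cong (w zero *_) (sym (∑∏omit≡esym (w ∘ suc)))) ⟨
  esym (tabulate (w ∘ suc)) (suc n) + w zero * esym (tabulate (w ∘ suc)) n
    ≡⟨ +-comm (esym (tabulate (w ∘ suc)) (suc n)) _ ⟩
  esym (tabulate w) (suc n) ∎
  where open ≡-Reasoning

skip : ∀ a {n} → Mask n → Mask (a + n)
skip zero    m       = m
skip (suc a) m zero    = false
skip (suc a) m (suc j) = skip a m j

skip-↑ʳ : ∀ a {n} (m : Mask n) i → skip a m (a ↑ʳ i) ≡ m i
skip-↑ʳ zero    m i = refl
skip-↑ʳ (suc a) m i = skip-↑ʳ a m i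

∣skip∣ : ∀ a {n} (m : Mask n) → ∣ skip a m ∣ ≡ ∣ m ∣
∣skip∣ zero    m = refl
∣skip∣ (suc a) m = ∣skip∣ a m

∏-skip : ∀ a {n} (m : Mask n) (w : Fin (a + n) → ℕ) → ∏[ skip a m ] w ≡ ∏[ m ] (w ∘ (a ↑ʳ_))
∏-skip zero    m w = refl
∏-skip (suc a) m w = ∏-skip a m (w ∘ suc)

skip-⊆ : ∀ a {n} {m m′ : Mask n} → m ⊆ m′ → skip a m ⊆ skip a m′
skip-⊆ zero    m⊆m′ = m⊆m′
skip-⊆ (suc a) m⊆m′ zero    ()
skip-⊆ (suc a) m⊆m′ (suc j) = skip-⊆ a m⊆m′ j

Row : ∀ {n} → (Fin n → ℕ) → Set
Row {n} L = (j : Fin n) → Fin (L j)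

_≈[_]_ : ∀ {n} {L : Fin n → ℕ} → Row L → Mask n → Row L → Set
R ≈[ m ] R′ = ∀ j → m j ≡ true → R j ≡ R′ j

≈-⊆ : ∀ {n} {L : Fin n → ℕ} {m m′ : Mask n} {R R′ : Row L} → m ⊆ m′ → R ≈[ m′ ] R′ → R ≈[ m ] R′
≈-⊆ m⊆m′ R≈R′ j mj = R≈R′ j (m⊆m′ j mj)

encode : ∀ {n} {L : Fin n → ℕ} (m : Mask n) → Row L → Fin (∏[ m ] L)
encode {zero}  m R = zero
encode {suc n} m R with m zero
... | true  = combine (R zero) (encode (m ∘ suc) (R ∘ suc))
... | false = encode (m ∘ suc) (R ∘ suc)

encode-cong : ∀ {n} {L : Fin n → ℕ} (m : Mask n) {R R′ : Row L} → R ≈[ m ] R′ → encode m R ≡ encode m R′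
encode-cong {zero}      m R≈R′ = refl
encode-cong {suc n} {L} m R≈R′ with m zero in m₀
... | true  = cong₂ combine (R≈R′ zero m₀) (encode-cong {L = L ∘ suc} (m ∘ suc) (R≈R′ ∘ suc))
... | false = encode-cong {L = L ∘ suc} (m ∘ suc) (R≈R′ ∘ suc)

encode-injective : ∀ {n} {L : Fin n → ℕ} (m : Mask n) {R R′ : Row L} → encode m R ≡ encode m R′ → R ≈[ m ] R′
encode-injective {suc n} {L} m {R} {R′} eq j mj with m zero in m₀
... | false with j
...   | zero  with () ← trans (sym m₀) mj
...   | suc j = encode-injective {L = L ∘ suc} (m ∘ suc) eq j mj
encode-injective {suc n} {L} m {R} {R′} eq j mj | true
  with combine-injective (R zero) (encode {L = L ∘ suc} (m ∘ suc) (λ j → R (suc j)))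
                         (R′ zero) (encode {L = L ∘ suc} (m ∘ suc) (λ j → R′ (suc j))) eq
... | R₀≡R′₀ , tail≡ with j
...   | zero  = R₀≡R′₀
...   | suc j = encode-injective {L = L ∘ suc} (m ∘ suc) tail≡ j mj

_∷ᴿ_ : ∀ {n} {L : Fin (suc n) → ℕ} → Fin (L zero) → Row (L ∘ suc) → Row L
(x ∷ᴿ R) zero    = x
(x ∷ᴿ R) (suc j) = R j

-- The row R₀ only witnesses that every level is nonempty.
encode-surjective : ∀ {n} {L : Fin n → ℕ} (m : Mask n) → Row L → Surjective (encode {L = L} m)
encode-surjective {zero}  m R₀ zero = R₀ , refl
encode-surjective {suc n} {L} m R₀ y with m zero
... | true with combine-surjective y
...   | x , y′ , combine≡y with encode-surjective {L = L ∘ suc} (m ∘ suc) (λ j → R₀ (suc j)) y′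
...     | R , encode≡y′ = x ∷ᴿ R , trans (cong (combine x) encode≡y′) combine≡y
encode-surjective {suc n} {L} m R₀ y | false with encode-surjective {L = L ∘ suc} (m ∘ suc) (λ j → R₀ (suc j)) y
...   | R , encode≡y = R₀ zero ∷ᴿ R , encode≡y

_[_]≔_ : ∀ {n} {L : Fin n → ℕ} → Row L → (c : Fin n) → Fin (L c) → Row L
(R [ c ]≔ x) j with j ≟ c
... | yes refl = x
... | no _     = R j

[]≔-at : ∀ {n} {L : Fin n → ℕ} (R : Row L) c x → (R [ c ]≔ x) c ≡ x
[]≔-at R c x with c ≟ c
... | yes refl = refl
... | no c≢c   = ⊥-elim (c≢c refl)

[]≔-off : ∀ {n} {L : Fin n → ℕ} {m : Mask n} (R : Row L) {c} x → m c ≡ false → (R [ c ]≔ x) ≈[ m ] R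
[]≔-off R {c} x mc≡false j mj with j ≟ c
... | yes refl with () ← trans (sym mj) mc≡false
... | no _     = refl

encode-column-surjective : ∀ {n} {L : Fin n → ℕ} (m : Mask n) {c} → m c ≡ false → Row L →
                           Surjective < encode {L = L} m , (λ (R : Row L) → R c) >
encode-column-surjective {L = L} m {c} mc≡false R₀ (y , x) =
  let R , encode≡y = encode-surjective {L = L} m R₀ y in
  R [ c ]≔ x , cong₂ _,_ (trans (encode-cong m ([]≔-off R x mc≡false)) encode≡y) ([]≔-at R c x)

select : ∀ {k} {F : Fin k → Set} → Mask k → ((j : Fin k) → F j) → (j : Fin k) → Maybe (F j)
select m R j = if m j then just (R j) else nothing

support-select : ∀ {k} {F : Fin k → Set} (m : Mask k) (R : (j : Fin k) → F j) → support (select m R) ≡ ∣ m ∣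
support-select {zero}  m R = refl
support-select {suc k} m R with m zero
... | true  = cong suc (support-select (m ∘ suc) (λ j → R (suc j)))
... | false = support-select (m ∘ suc) (λ j → R (suc j))

select-mask : ∀ {k} {F : Fin k → Set} (m m′ : Mask k) (R R′ : (j : Fin k) → F j) j →
              select m R j ≡ select m′ R′ j → m j ≡ m′ j
select-mask m m′ R R′ j eq with m j | m′ j
... | true  | true  = refl
... | false | false = refl
... | true  | false with () ← eq
... | false | true  with () ← eq

module Interactions {N k v} (A : Array N k v) where

  interactionOn : ∀ {t} (m : Mask k) → ∣ m ∣ ≡ t → Row (Level k v) → Interaction t k v
  interactionOn m ∣m∣≡t R = interaction (select m R) (trans (support-select m R) ∣m∣≡t)

  ∈ρ⇔≈ : ∀ {t} m (∣m∣≡t : ∣ m ∣ ≡ t) R r → InRho A (interactionOn m ∣m∣≡t R) r ⇔ A r ≈[ m ] R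
  ∈ρ⇔≈ m ∣m∣≡t R r = mk⇔ ∈ρ⇒≈ ≈⇒∈ρ
    where
    ∈ρ⇒≈ : InRho A (interactionOn m ∣m∣≡t R) r → A r ≈[ m ] R
    ∈ρ⇒≈ ∈ρ j mj = ∈ρ j (R j) (cong (λ b → if b then just (R j) else nothing) mj)
    ≈⇒∈ρ : A r ≈[ m ] R → InRho A (interactionOn m ∣m∣≡t R) r
    ≈⇒∈ρ A≈R j x sel≡x with m j in mj
    ≈⇒∈ρ A≈R j x refl | true = A≈R j mj

  project : (m : Mask k) → Fin N → Fin (∏[ m ] Level k v)
  project m r = encode m (A r)

  alone⇒ρ-singleton : ∀ {t m} (∣m∣≡t : ∣ m ∣ ≡ t) {r} → Alone (project m) r →
                      ∀ r′ → InRho A (interactionOn m ∣m∣≡t (A r)) r′ ⇔ r′ ≡ r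
  alone⇒ρ-singleton {m = m} ∣m∣≡t {r} alone r′ =
    mk⇔ (λ ∈ρ → alone (encode-cong m (Equivalence.to (∈ρ⇔≈ m ∣m∣≡t (A r) r′) ∈ρ)))
        (λ { refl → Equivalence.from (∈ρ⇔≈ m ∣m∣≡t (A r) r) (λ _ _ → refl) })

  module _ {t} (isLA : IsLA1 N t k v A) where

    project-surjective : ∀ {m} → ∣ m ∣ ≡ t → Row (Level k v) → Surjective (project m)
    project-surjective {m} ∣m∣≡t R₀ y with encode-surjective m R₀ y
    ... | R , encode≡y with any? (λ r → project m r ≟ y)
    ...   | yes hit = hit
    ...   | no miss = ⊥-elim (Equivalence.to (isLA (just (interactionOn m ∣m∣≡t R)) nothing) never-hit)
      where
      never-hit : ∀ r → InRho A (interactionOn m ∣m∣≡t R) r ⇔ ⊥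
      never-hit r = mk⇔ (λ ∈ρ → miss (r , trans (encode-cong m (Equivalence.to (∈ρ⇔≈ m ∣m∣≡t R r) ∈ρ)) encode≡y))
                        ⊥-elim

    alone-masks-agree : ∀ {m m′} → ∣ m ∣ ≡ t → ∣ m′ ∣ ≡ t → ∀ {r} →
                        Alone (project m) r → Alone (project m′) r → ∀ j → m j ≡ m′ j
    alone-masks-agree {m} {m′} ∣m∣≡t ∣m′∣≡t {r} alone alone′ j =
      select-mask m m′ (A r) (A r) j (Equivalence.to (isLA (just T) (just T′)) same-ρ j)
      where
      T  = interactionOn m  ∣m∣≡t  (A r)
      T′ = interactionOn m′ ∣m′∣≡t (A r)
      same-ρ : ∀ r′ → InRho A T r′ ⇔ InRho A T′ r′
      same-ρ r′ = ⇔-sym (alone⇒ρ-singleton ∣m′∣≡t alone′ r′) ⇔-∘ alone⇒ρ-singleton ∣m∣≡t alone r′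

    module _ {m m′ : Mask k} {c : Fin k} (m⊆m′ : m ⊆ m′) (m′c≡true : m′ c ≡ true) where

      refine-surjective : ∣ m′ ∣ ≡ t → m c ≡ false → Row (Level k v) → Surjective < project m , (λ r → A r c) >
      refine-surjective ∣m′∣≡t mc≡false R₀ (σ , x) =
        let R , encode≡  = encode-column-surjective m mc≡false R₀ (σ , x)
            r , project≡ = project-surjective ∣m′∣≡t R₀ (encode m′ R)
            Ar≈R         = encode-injective m′ project≡
        in r , cong₂ _,_ (trans (encode-cong m (≈-⊆ m⊆m′ Ar≈R)) (,-injectiveˡ encode≡))
                         (trans (Ar≈R c m′c≡true) (,-injectiveʳ encode≡))

      refine-alone : ∀ {r} → Alone < project m , (λ r → A r c) > r → Alone (project m′) r
      refine-alone alone project≡ =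
        let Ar′≈Ar = encode-injective m′ project≡
        in alone (cong₂ _,_ (encode-cong m (≈-⊆ m⊆m′ Ar′≈Ar)) (Ar′≈Ar c m′c≡true))

omit₀₁ : ∀ {n} → Mask (suc (suc n))
omit₀₁ zero          = false
omit₀₁ (suc zero)    = false
omit₀₁ (suc (suc i)) = true

omit₀₁⊆omit₀ : ∀ {n} → omit₀₁ {n} ⊆ omit zero
omit₀₁⊆omit₀ (suc (suc i)) _ = refl

omit₀₁⊆omit₁ : ∀ {n} → omit₀₁ {n} ⊆ omit (suc zero)
omit₀₁⊆omit₁ (suc (suc i)) _ = refl

levelsAfter : ∀ {n} → ℕ → (ℕ → ℕ) → Fin n → ℕ
levelsAfter a v i = v (suc (a + toℕ i))

Level-↑ʳ : ∀ a {n} v (i : Fin n) → Level (a + n) v (a ↑ʳ i) ≡ levelsAfter a v i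
Level-↑ʳ a v i = cong (v ∘ suc) (toℕ-↑ʳ a i)

∏-skip-Level : ∀ a {n} v (m : Mask n) → ∏[ skip a m ] Level (a + n) v ≡ ∏[ m ] levelsAfter a v
∏-skip-Level a v m = trans (∏-skip a m (Level (a + _) v)) (∏-cong m (Level-↑ʳ a v))

∣skip-omit∣ : ∀ a {t} (d : Fin (suc t)) → ∣ skip a (omit d) ∣ ≡ t
∣skip-omit∣ a d = trans (∣skip∣ a (omit d)) (∣omit∣ d)

module _ {N a t v} (A : Array N (a + suc t) v) (isLA : IsLA1 N t (a + suc t) v A)
         (R₀ : Row (Level (a + suc t) v)) where

  open Interactions {v = v} A

  esym-bound : 2 * esym (tabulate (levelsAfter {suc t} a v)) t ≤ suc (suc t) * N
  esym-bound = subst (λ E → 2 * E ≤ suc (suc t) * N) ∑∏≡esym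
    (disjoint-singletons-bound (λ d → project (skip a (omit d)))
      (λ d → project-surjective isLA (∣skip-omit∣ a d) R₀) alone-unique)
    where
    ∑∏≡esym : ∑[ d < suc t ] ∏[ skip a (omit d) ] Level (a + suc t) v ≡ esym (tabulate (levelsAfter {suc t} a v)) t
    ∑∏≡esym = trans (sum-cong-≗ (∏-skip-Level a v ∘ omit)) (∑∏omit≡esym {t} (levelsAfter a v))

    alone-unique : ∀ r {d d′} → Alone (project (skip a (omit d))) r → Alone (project (skip a (omit d′))) r → d ≡ d′
    alone-unique r {d} {d′} alone alone′ = omit-injective λ i → begin
      omit d i                   ≡⟨ skip-↑ʳ a (omit d) i ⟨
      skip a (omit d) (a ↑ʳ i)   ≡⟨ alone-masks-agree isLA (∣skip-omit∣ a d) (∣skip-omit∣ a d′) alone alone′ (a ↑ʳ i) ⟩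
      skip a (omit d′) (a ↑ʳ i)  ≡⟨ skip-↑ʳ a (omit d′) i ⟩
      omit d′ i                  ∎
      where open ≡-Reasoning

module _ {N a t v} (A : Array N (a + suc (suc t)) v) (isLA : IsLA1 N (suc t) (a + suc (suc t)) v A)
         (R₀ : Row (Level (a + suc (suc t)) v)) where

  open Interactions {v = v} A

  product-bound : levelsAfter {suc (suc t)} a v (suc zero) < 2 * levelsAfter {suc (suc t)} a v zero →
                  product (tabulate (λ (i : Fin t) → levelsAfter a v (suc (suc i)))) *
                    suc (levelsAfter {suc (suc t)} a v (suc zero)) ≤ N
  product-bound α<2β = subst₂ (λ P x → P * suc x ≤ N) ∏mJ≡ (Level-↑ʳ a v (suc zero))
    (refined-fibres-bound (project mJ) (λ r → A r α) (λ r → A r β) α<2β′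
      (refine-surjective isLA mJ⊆mα mα-α (∣skip-omit∣ a zero) (skip-↑ʳ a omit₀₁ (suc zero)) R₀)
      (refine-surjective isLA mJ⊆mβ mβ-β (∣skip-omit∣ a (suc zero)) (skip-↑ʳ a omit₀₁ zero) R₀)
      not-both)
    where
    open ≡-Reasoning
    -- β and α are the paper's columns k − t and k − t + 1; mJ selects the columns after them.
    mJ mα mβ : Mask (a + suc (suc t))
    mJ = skip a omit₀₁
    mα = skip a (omit zero)
    mβ = skip a (omit (suc zero))
    α β : Fin (a + suc (suc t))
    α = a ↑ʳ suc zero
    β = a ↑ʳ zero
    mJ⊆mα : mJ ⊆ mα
    mJ⊆mα = skip-⊆ a omit₀₁⊆omit₀
    mJ⊆mβ : mJ ⊆ mβ
    mJ⊆mβ = skip-⊆ a omit₀₁⊆omit₁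
    mα-α : mα α ≡ true
    mα-α = skip-↑ʳ a (omit zero) (suc zero)
    mβ-β : mβ β ≡ true
    mβ-β = skip-↑ʳ a (omit (suc zero)) zero
    α<2β′ : Level _ v α < 2 * Level _ v β
    α<2β′ = subst₂ (λ x y → x < 2 * y) (sym (Level-↑ʳ a v (suc zero))) (sym (Level-↑ʳ a v zero)) α<2β
    not-both : ∀ r → Alone < project mJ , (λ r → A r α) > r → Alone < project mJ , (λ r → A r β) > r → ⊥
    not-both r alone-α alone-β with () ← begin
      false  ≡⟨ skip-↑ʳ a (omit zero) zero ⟨
      mα β   ≡⟨ alone-masks-agree isLA (∣skip-omit∣ a zero) (∣skip-omit∣ a (suc zero))
                  (refine-alone isLA mJ⊆mα mα-α alone-α) (refine-alone isLA mJ⊆mβ mβ-β alone-β) β ⟩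
      mβ β   ≡⟨ skip-↑ʳ a (omit (suc zero)) zero ⟩
      true   ∎
    ∏mJ≡ : ∏[ mJ ] Level (a + suc (suc t)) v ≡ product (tabulate (λ (i : Fin t) → levelsAfter a v (suc (suc i))))
    ∏mJ≡ = trans (∏-skip-Level a v omit₀₁) (∏-full {m = λ (i : Fin t) → omit₀₁ (suc (suc i))} (λ _ → refl) _)

⌈/⌉≤ : ∀ X d N → X ≤ suc d * N → ⌈ X / suc d ⌉ ≤ N
⌈/⌉≤ X d N X≤ = ≤-pred (m<n*o⇒m/o<n (begin-strict
  X + suc d ∸ 1      ≡⟨ cong (_∸ 1) (+-suc X d) ⟩
  X + d              <⟨ +-mono-≤-< X≤ (n<1+n d) ⟩
  suc d * N + suc d  ≡⟨ cong (_+ suc d) (*-comm (suc d) N) ⟩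
  N * suc d + suc d  ≡⟨ +-comm (N * suc d) (suc d) ⟩
  suc N * suc d      ∎))
  where open ≤-Reasoning

applyUpTo≡tabulate : ∀ (f : ℕ → ℕ) n → applyUpTo f n ≡ tabulate (λ (i : Fin n) → f (toℕ i))
applyUpTo≡tabulate f zero    = refl
applyUpTo≡tabulate f (suc n) = cong (f 0 ∷_) (applyUpTo≡tabulate (f ∘ suc) n)

map-range : ∀ (v : ℕ → ℕ) {b e n} → suc e ≡ b + n → map v (range b e) ≡ tabulate (λ (i : Fin n) → v (b + toℕ i))
map-range v {b} {e} {n} 1+e≡b+n = begin
  map v (map (b +_) (upTo (suc e ∸ b)))  ≡⟨ cong (λ l → map v (map (b +_) (upTo l))) (trans (cong (_∸ b) 1+e≡b+n) (m+n∸m≡n b n)) ⟩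
  map v (map (b +_) (upTo n))            ≡⟨ map-∘ (upTo n) ⟨
  map (v ∘ (b +_)) (upTo n)              ≡⟨ map-upTo (v ∘ (b +_)) n ⟩
  applyUpTo (v ∘ (b +_)) n               ≡⟨ applyUpTo≡tabulate (v ∘ (b +_)) n ⟩
  tabulate (λ i → v (b + toℕ i))         ∎
  where open ≡-Reasoning

∸-after : ∀ a t x → a + suc t ∸ t + x ≡ suc (a + x)
∸-after a t x = cong (_+ x) (trans (cong (_∸ t) (+-suc a t)) (m+n∸n≡m (suc a) t))

map-range-after : ∀ (v : ℕ → ℕ) a t s {n} → s + n ≡ suc t →
                  map v (range (a + suc t ∸ t + s) (a + suc t)) ≡ tabulate (λ (i : Fin n) → v (suc (a + (s + toℕ i))))
map-range-after v a t s {n} s+n≡1+t =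
  trans (map-range v (sym (trans (shift n) (cong (λ y → suc (a + y)) s+n≡1+t))))
        (tabulate-cong (λ i → cong v (shift (toℕ i))))
  where
  shift : ∀ x → a + suc t ∸ t + s + x ≡ suc (a + (s + x))
  shift x = trans (+-assoc (a + suc t ∸ t) s x) (∸-after a t (s + x))

boundM-after : ∀ a t v → 1 ≤ t → v (a + suc t ∸ t + 1) < 2 * v (a + suc t ∸ t) →
               ∀ N (A : Array N (a + suc t) v) → IsLA1 N t (a + suc t) v A → Row (Level (a + suc t) v) →
               boundM t (a + suc t) v ≤ N
boundM-after a (suc zero) v _ _ N A isLA R₀ =
  ⌈/⌉≤ (2 * v (a + 2 ∸ 1) + 2 * v (a + 2)) 2 N (subst (_≤ 3 * N) (sym pair-sum) (esym-bound A isLA R₀))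
  where
  open ≡-Reasoning
  pair-sum : 2 * v (a + 2 ∸ 1) + 2 * v (a + 2) ≡ 2 * esym (tabulate (levelsAfter {2} a v)) 1
  pair-sum = begin
    2 * v (a + 2 ∸ 1) + 2 * v (a + 2)   ≡⟨ *-distribˡ-+ 2 (v (a + 2 ∸ 1)) (v (a + 2)) ⟨
    2 * (v (a + 2 ∸ 1) + v (a + 2))     ≡⟨ cong (λ x → 2 * (v x + v (a + 2))) (trans (sym (+-identityʳ _)) (∸-after a 1 0)) ⟩
    2 * (v (suc (a + 0)) + v (a + 2))   ≡⟨ cong (λ x → 2 * (v (suc (a + 0)) + v x)) (+-suc a 1) ⟩
    2 * (v (suc (a + 0)) + v (suc (a + 1)))
      ≡⟨ cong₂ (λ x y → 2 * (x + y)) (*-identityʳ (v (suc (a + 0))))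
                                     (trans (+-identityʳ (v (suc (a + 1)) * 1)) (*-identityʳ (v (suc (a + 1))))) ⟨
    2 * esym (tabulate (levelsAfter {2} a v)) 1 ∎
boundM-after a (suc (suc t)) v _ α<2β N A isLA R₀ = ⊔-lub
  (⌈/⌉≤ (2 * esym (map v (range (k ∸ T) k)) T) (suc (t + 2)) N
    (subst₂ (λ E c → 2 * E ≤ suc (suc c) * N) (sym esym≡) (+-comm 2 t) (esym-bound A isLA R₀)))
  (subst₂ (λ x y → x + y ≤ N) (sym αJ≡) (sym J≡)
    (subst (_≤ N) (P*[1+w]≡w*P+P (product (tabulate (λ (i : Fin (suc t)) → v (suc (a + (2 + toℕ i)))))) (v (suc (a + 1))))
      (product-bound A isLA R₀ α<2β′)))
  where
  T = suc (suc t)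
  k = a + suc T
  esym≡ : esym (map v (range (k ∸ T) k)) T ≡ esym (tabulate (levelsAfter a v)) T
  esym≡ = cong (λ l → esym l T) (trans (cong (λ b → map v (range b k)) (sym (+-identityʳ (k ∸ T))))
                                        (map-range-after v a T 0 refl))
  αJ≡ : prodRange v (k ∸ T + 1) k ≡ product (tabulate (λ (i : Fin T) → v (suc (a + (1 + toℕ i)))))
  αJ≡ = cong product (map-range-after v a T 1 refl)
  J≡ : prodRange v (k ∸ T + 2) k ≡ product (tabulate (λ (i : Fin (suc t)) → v (suc (a + (2 + toℕ i)))))
  J≡ = cong product (map-range-after v a T 2 refl)
  α<2β′ : v (suc (a + 1)) < 2 * v (suc (a + 0))
  α<2β′ = subst₂ (λ x y → v x < 2 * v y) (∸-after a T 1) (trans (sym (+-identityʳ _)) (∸-after a T 0)) α<2β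
  P*[1+w]≡w*P+P : ∀ P w → P * suc w ≡ w * P + P
  P*[1+w]≡w*P+P P w = trans (*-suc P w) (trans (+-comm P (P * w)) (cong (_+ P) (*-comm P w)))

lemma3p4 : (k t : ℕ) (v : ℕ → ℕ) → 1 ≤ t → t < k →
    (∀ i → 1 ≤ i → i ≤ k → 2 ≤ v i) →
    (∀ i → 1 ≤ i → i < k → v i ≤ v (suc i)) →
    v (k ∸ t) < v (k ∸ t + 1) → v (k ∸ t + 1) < 2 * v (k ∸ t) →
    (N : ℕ) (A : Array N k v) → IsLA1 N t k v A → boundM t k v ≤ N
lemma3p4 k t v 1≤t t<k 2≤v _ _ α<2β N A isLA with k ∸ suc t | m∸n+n≡m t<k
... | a | refl = boundM-after a t v 1≤t α<2β N A isLA (λ j → fromℕ< (2≤v (suc (toℕ j)) (s≤s z≤n) (toℕ<n j)))
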